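{- Let $k\ge2$ and let $B=(1,b_2,\dots,b_k)$ be positive integers with $1<b_2<\cdots<b_k$ forming an orderly sequence; let $c=\max\{O_B(r)\mid 0\le r\le b_k-1\}$ and suppose $c\ge2$. Let $a,h,d$ be positive integers with $\gcd(a,d)=1$ and, for $0\le r\le a-1$, let $N_{dr}:=\min\{O_B(ma+r)\cdot ha+(ma+r)d\mid m\in\mathbb{N}\}$. If $a\ge(c-1)b_k$, then $$\max_{0\le r\le a-1}N_{dr}=\max_{a-b_k\le r\le a-1}N_{dr}.$$
   Context: For $M\in\mathbb{N}$, $O_B(M):=\min\{\sum_{i=1}^k x_i \mid \sum_{i=1}^k b_ix_i=M,\ x_i\in\mathbb{N}\}$ with $b_1=1$. Let $G_B(M)$ be the number of parts used by the greedy strategy (use as many copies of $b_k$ as possible, then of $b_{k-1}$, and so on). $B$ is orderly if $O_B(M)=G_B(M)$ for all $M\in\mathbb{N}$. -}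

module Defs where

open import Data.Nat using (ℕ; zero; suc; _+_; _*_; _∸_; _≤_; _<_)
open import Data.Nat.DivMod using (_/_; _%_)
open import Data.Fin using (Fin; fromℕ; inject₁)
import Data.Fin as F
open import Data.Product using (Σ; _×_; ∃)
open import Relation.Binary.PropositionalEquality using (_≡_)

∑ : (n : ℕ) → (Fin n → ℕ) → ℕ
∑ zero    f = 0
∑ (suc n) f = f F.zero + ∑ n (λ i → f (F.suc i))

-- a coin system B = (b_1,...,b_k), k = suc n, given as a function on Fin k
-- x is a representation of M with p parts
Rep : (n : ℕ) → (Fin (suc n) → ℕ) → ℕ → ℕ → Set
Rep n b M p = Σ (Fin (suc n) → ℕ) λ x →
  (∑ (suc n) (λ i → b i * x i) ≡ M) × (∑ (suc n) x ≡ p)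

IsMin : (ℕ → Set) → ℕ → Set
IsMin P v = P v × (∀ u → P u → v ≤ u)

IsMax : (ℕ → Set) → ℕ → Set
IsMax P v = P v × (∀ u → P u → u ≤ v)

IsO : (n : ℕ) → (Fin (suc n) → ℕ) → ℕ → ℕ → Set
IsO n b M p = IsMin (Rep n b M) p

-- division / remainder with the convention x/0 = 0, x%0 = x (never used for positive coins)
div0 : ℕ → ℕ → ℕ
div0 M zero    = 0
div0 M (suc b) = M / suc b

mod0 : ℕ → ℕ → ℕ
mod0 M zero    = M
mod0 M (suc b) = M % suc b

greedy : (k : ℕ) → (Fin k → ℕ) → ℕ → ℕ
greedy zero    b M = 0
greedy (suc k) b M =
  div0 M (b (fromℕ k)) + greedy k (λ i → b (inject₁ i)) (mod0 M (b (fromℕ k)))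

G : (n : ℕ) → (Fin (suc n) → ℕ) → ℕ → ℕ
G n b M = greedy (suc n) b M

Orderly : (n : ℕ) → (Fin (suc n) → ℕ) → Set
Orderly n b = ∀ M → IsO n b M (G n b M)

NVal : (n : ℕ) → (Fin (suc n) → ℕ) → (a h d r : ℕ) → ℕ → Set
NVal n b a h d r u = Σ ℕ λ m → Σ ℕ λ o →
  IsO n b (m * a + r) o × (u ≡ o * h * a + (m * a + r) * d)

IsN : (n : ℕ) → (Fin (suc n) → ℕ) → (a h d r : ℕ) → ℕ → Set
IsN n b a h d r v = IsMin (NVal n b a h d r) v

-- For an orderly system the greedy count satisfies G(M + b_k) = G(M) + 1, so O_B(M + b_k) = O_B(M) + 1.
-- Hence every candidate value for N_{d(r+b_k)} dominates one for N_{dr}, i.e. N_{dr} ≤ N_{d(r+b_k)}.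
-- Climbing from any residue r < a in steps of b_k reaches the window a - b_k ≤ r' < a without
-- decreasing N, so the overall maximum is already attained in that window.
module Submission where

open import Defs
open import Data.Nat using (ℕ; zero; suc; _+_; _*_; _∸_; _≤_; _<_; z≤n; s≤s; _≤?_; >-nonZero)
open import Data.Nat.Properties
open import Data.Nat.DivMod using (_/_; m/n≡1+[m∸n]/n; [m+n]%n≡m%n)
open import Data.Nat.Induction using (<-wellFounded)
open import Data.Nat.GCD using (gcd)
open import Data.Fin using (Fin; fromℕ)
import Data.Fin as F
open import Data.Product using (Σ; Σ-syntax; _×_; ∃; _,_; proj₁; proj₂)
open import Data.Sum using (inj₁; inj₂)
open import Function using (flip)
open import Induction.WellFounded using (Acc; acc)
open import Level using (0ℓ)
open import Relation.Binary.Core using (Rel)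
open import Relation.Binary.Definitions using (Reflexive; Transitive; Total)
open import Relation.Nullary using (yes; no)
open import Relation.Binary.PropositionalEquality using (_≡_; refl; sym; cong; cong₂; subst; module ≡-Reasoning)

IsMin-unique : ∀ {P : ℕ → Set} {x y} → IsMin P x → IsMin P y → x ≡ y
IsMin-unique (px , x≤) (py , y≤) = ≤-antisym (x≤ _ py) (y≤ _ px)

optimum-≤ : ∀ {R : Rel ℕ 0ℓ} → Reflexive R → Transitive R → Total R →
  (f : ℕ → ℕ) (k : ℕ) → Σ[ m ∈ ℕ ] m ≤ k × (∀ {m′} → m′ ≤ k → R (f m) (f m′))
optimum-≤ refl′ _ _ f zero = 0 , z≤n , λ { z≤n → refl′ }
optimum-≤ {R} refl′ trans′ total f (suc k) with optimum-≤ refl′ trans′ total f k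
... | m , m≤k , opt with total (f m) (f (suc k))
...   | inj₁ fm-R = m , m≤n⇒m≤1+n m≤k , still-optimal
  where
  still-optimal : ∀ {m′} → m′ ≤ suc k → R (f m) (f m′)
  still-optimal m′≤ with m≤n⇒m<n∨m≡n m′≤
  ... | inj₁ m′<  = opt (≤-pred m′<)
  ... | inj₂ refl = fm-R
...   | inj₂ R-fm = suc k , ≤-refl , new-optimal
  where
  new-optimal : ∀ {m′} → m′ ≤ suc k → R (f (suc k)) (f m′)
  new-optimal m′≤ with m≤n⇒m<n∨m≡n m′≤
  ... | inj₁ m′<  = trans′ R-fm (opt (≤-pred m′<))
  ... | inj₂ refl = refl′

argmin-coercive : (f : ℕ → ℕ) → (∀ m → m ≤ f m) → Σ[ m ∈ ℕ ] (∀ m′ → f m ≤ f m′)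
argmin-coercive f coercive with optimum-≤ ≤-refl ≤-trans ≤-total f (f 0)
... | m , _ , opt = m , least
  where
  -- beyond f 0 the search is pointless: there f m′ ≥ m′ > f 0 ≥ f m
  least : ∀ m′ → f m ≤ f m′
  least m′ with m′ ≤? f 0
  ... | yes m′≤ = opt m′≤
  ... | no  m′≰ = ≤-trans (opt z≤n) (≤-trans (<⇒≤ (≰⇒> m′≰)) (coercive m′))

argmax-< : (f : ℕ → ℕ) (a : ℕ) → 1 ≤ a → Σ[ r ∈ ℕ ] r < a × (∀ {r′} → r′ < a → f r′ ≤ f r)
argmax-< f (suc a) _ with optimum-≤ ≤-refl (flip ≤-trans) (flip ≤-total) f a
... | r , r≤a , opt = r , s≤s r≤a , λ r′< → opt (≤-pred r′<)

step-below-window : ∀ {a B r} → 1 ≤ B → r < a ∸ B → r + B < a × a ∸ (r + B) < a ∸ r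
step-below-window {a} {B} {r} B≥1 r<a∸B = r+B<a , ∸-monoʳ-< (m<m+n r B≥1) (<⇒≤ r+B<a)
  where
  B≤a : B ≤ a
  B≤a = <⇒≤ (m∸n≢0⇒n<m λ a∸B≡0 → <⇒≱ r<a∸B (subst (_≤ r) (sym a∸B≡0) z≤n))
  r+B<a : r + B < a
  r+B<a = m≤o∸n⇒m+n≤o (suc r) B≤a r<a∸B

climb-to-window : (f : ℕ → ℕ) (B : ℕ) → 1 ≤ B → (∀ r → f r ≤ f (r + B)) →
  ∀ {a r} → r < a → Σ[ r′ ∈ ℕ ] a ∸ B ≤ r′ × r′ < a × f r ≤ f r′
climb-to-window f B B≥1 step {a} {r} = go (<-wellFounded (a ∸ r))
  where
  go : ∀ {r} → Acc _<_ (a ∸ r) → r < a → Σ[ r′ ∈ ℕ ] a ∸ B ≤ r′ × r′ < a × f r ≤ f r′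
  go {r} (acc rec) r<a with a ∸ B ≤? r
  ... | yes in-window = r , in-window , r<a , ≤-refl
  ... | no below-window
    with r+B<a , gap-shrinks ← step-below-window B≥1 (≰⇒> below-window)
    with r′ , in-window , r′<a , fr+B≤fr′ ← go (rec gap-shrinks) r+B<a
    = r′ , in-window , r′<a , ≤-trans (step r) fr+B≤fr′

window-max : (f : ℕ → ℕ) (B : ℕ) → 1 ≤ B → (∀ r → f r ≤ f (r + B)) → ∀ {a} → 1 ≤ a →
  Σ[ r′ ∈ ℕ ] a ∸ B ≤ r′ × r′ < a × (∀ {r} → r < a → f r ≤ f r′)
window-max f B B≥1 step {a} a≥1 =
  let r , r<a , r-max = argmax-< f a a≥1
      r′ , in-window , r′<a , fr≤fr′ = climb-to-window f B B≥1 step r<a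
  in r′ , in-window , r′<a , λ s<a → ≤-trans (r-max s<a) fr≤fr′

div0-+ : ∀ M B → 1 ≤ B → div0 (M + B) B ≡ suc (div0 M B)
div0-+ M B@(suc _) _ = begin
  (M + B) / B           ≡⟨ m/n≡1+[m∸n]/n (m≤n+m B M) ⟩
  suc ((M + B ∸ B) / B) ≡⟨ cong (λ x → suc (x / B)) (m+n∸n≡m M B) ⟩
  suc (M / B)           ∎
  where open ≡-Reasoning

mod0-+ : ∀ M B → mod0 (M + B) B ≡ mod0 M B
mod0-+ M zero    = +-identityʳ M
mod0-+ M (suc B) = [m+n]%n≡m%n M (suc B)

G-+-top : ∀ n (b : Fin (suc n) → ℕ) → 1 ≤ b (fromℕ n) →
  ∀ M → G n b (M + b (fromℕ n)) ≡ suc (G n b M)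
G-+-top n b B≥1 M = cong₂ _+_ (div0-+ M B B≥1) (cong (greedy n _) (mod0-+ M B))
  where B = b (fromℕ n)

module _ {n} (b : Fin (suc n) → ℕ) (ord : Orderly n b) (a h d : ℕ) where

  cost : ℕ → ℕ → ℕ
  cost r m = G n b (m * a + r) * h * a + (m * a + r) * d

  NVal⇒cost : ∀ {r u} → NVal n b a h d r u → Σ[ m ∈ ℕ ] u ≡ cost r m
  NVal⇒cost {r} (m , o , isO , refl) rewrite IsMin-unique isO (ord (m * a + r)) = m , refl

  cost-+-top : 1 ≤ b (fromℕ n) → ∀ r m → cost r m ≤ cost (r + b (fromℕ n)) m
  cost-+-top B≥1 r m rewrite sym (+-assoc (m * a) r (b (fromℕ n))) | G-+-top n b B≥1 (m * a + r) =
    +-mono-≤ (*-monoˡ-≤ a (*-monoˡ-≤ h (n≤1+n (G n b (m * a + r))))) (*-monoˡ-≤ d (m≤m+n (m * a + r) _))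

  cost-coercive : 1 ≤ a → 1 ≤ d → ∀ r m → m ≤ cost r m
  cost-coercive a≥1 d≥1 r m =
    ≤-trans (m≤m*n m a {{>-nonZero a≥1}})
    (≤-trans (m≤m+n _ r)
    (≤-trans (m≤m*n _ d {{>-nonZero d≥1}}) (m≤n+m _ _)))

  IsN-exists : 1 ≤ a → 1 ≤ d → ∀ r → ∃ (IsN n b a h d r)
  IsN-exists a≥1 d≥1 r =
    let m , least = argmin-coercive (cost r) (cost-coercive a≥1 d≥1 r)
    in cost r m , (m , _ , ord _ , refl) , λ u u-val →
         let m′ , u≡ = NVal⇒cost u-val in subst (cost r m ≤_) (sym u≡) (least m′)

  IsN-mono-+-top : 1 ≤ b (fromℕ n) → ∀ {r u v} →
    IsN n b a h d r u → IsN n b a h d (r + b (fromℕ n)) v → u ≤ v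
  IsN-mono-+-top B≥1 {r} (_ , u-least) (v-val , _) with m , refl ← NVal⇒cost v-val =
    ≤-trans (u-least _ (m , _ , ord _ , refl)) (cost-+-top B≥1 r m)

lemma4p2 : (n : ℕ) → 1 ≤ n → (b : Fin (suc n) → ℕ) →
    b F.zero ≡ 1 → (∀ i j → i F.< j → b i < b j) → Orderly n b →
    (c : ℕ) → IsMax (λ u → Σ ℕ λ r → r < b (fromℕ n) × IsO n b r u) c → 2 ≤ c →
    (a h d : ℕ) → 1 ≤ a → 1 ≤ h → 1 ≤ d → gcd a d ≡ 1 →
    (c ∸ 1) * b (fromℕ n) ≤ a →
    Σ ℕ λ v →
      IsMax (λ u → Σ ℕ λ r → r < a × IsN n b a h d r u) v ×
      IsMax (λ u → Σ ℕ λ r → a ∸ b (fromℕ n) ≤ r × r < a × IsN n b a h d r u) v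
lemma4p2 n@(suc _) _ b _ increasing ord _ _ _ a h d a≥1 _ d≥1 _ _ =
  let r′ , in-window , r′<a , r′-max = window-max N B B≥1 N-+-top a≥1
      bounded : ∀ {r u} → r < a → IsN n b a h d r u → u ≤ N r′
      bounded r<a isN = subst (_≤ N r′) (IsMin-unique (N-spec _) isN) (r′-max r<a)
  in N r′ , ((r′ , r′<a , N-spec r′) , λ { _ (_ , r<a , isN) → bounded r<a isN })
          , ((r′ , in-window , r′<a , N-spec r′) , λ { _ (_ , _ , r<a , isN) → bounded r<a isN })
  where
  B = b (fromℕ n)
  B≥1 : 1 ≤ B
  B≥1 = ≤-trans (s≤s z≤n) (increasing F.zero (fromℕ n) (s≤s z≤n))
  N : ℕ → ℕ
  N r = proj₁ (IsN-exists b ord a h d a≥1 d≥1 r)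
  N-spec : ∀ r → IsN n b a h d r (N r)
  N-spec r = proj₂ (IsN-exists b ord a h d a≥1 d≥1 r)
  N-+-top : ∀ r → N r ≤ N (r + B)
  N-+-top r = IsN-mono-+-top b ord a h d B≥1 (N-spec r) (N-spec (r + B))
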